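{- Let $(d_n)_{n\ge 0}$ be the period-doubling sequence, defined by $d_{2n}=1$, $d_{4n+1}=0$, $d_{4n+3}=d_n$ for all $n\ge 0$, and let $\mathrm{sum}_{\mathrm{pd}}(n)=\sum_{i=0}^{n} d_i$. Then for every integer $r\ge0$, $$\mathrm{sum}_{\mathrm{pd}}\!\left(\frac{4^{r+1}-1}{3}\right)=\frac{2\cdot 4^{r+1}+3r+1}{9}.$$ -}

module Defs where

open import Data.Nat using (ℕ; zero; suc; _+_; _*_; _∸_; _^_; _/_; _%_)
open import Data.Bool using (if_then_else_)
open import Data.Nat using (_≡ᵇ_)

-- Auxiliary: evaluate the recursion with a fuel bound (fuel n is enough
-- for argument n, since n ↦ n / 4 strictly decreases for n ≥ 3).
pdFuel : ℕ → ℕ → ℕ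
pdFuel zero    n = 1
pdFuel (suc f) n =
  if n % 2 ≡ᵇ 0 then 1
  else if n % 4 ≡ᵇ 1 then 0
  else pdFuel f (n / 4)

pd : ℕ → ℕ
pd n = pdFuel (suc n) n

sumPd : ℕ → ℕ
sumPd zero    = pd 0
sumPd (suc n) = sumPd n + pd (suc n)

{-# OPTIONS --safe #-}
-- Grouping the terms in blocks d(4j), d(4j+1), d(4j+2), d(4j+3) = 1, 0, 1, d(j) gives
-- Σ_{i<4k} d_i = 2k + Σ_{i<k} d_i.  The index (4^(r+1) − 1)/3 = 1 + 4 + ⋯ + 4^r is 4m + 1 with
-- m = (4^r − 1)/3, so the partial sums along these indices satisfy a first-order linear
-- recurrence in r, whose solution is the closed form.
module Submission where

open import Defs
open import Data.Nat using (ℕ; zero; suc; _+_; _*_; _∸_; _^_; _/_; _%_; _≡ᵇ_; _<_; s≤s; z≤n)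
open import Data.Bool using (if_then_else_)
open import Data.Nat.Properties using (≤-trans; ≤-refl; m≤n⇒m≤o+n; m≤m*n; *-assoc; +-comm; +-identityʳ; m+n∸n≡m)
open import Data.Nat.Divisibility using (_∣_; divides)
open import Data.Nat.DivMod using (+-distrib-/-∣ʳ; %-remove-+ʳ; m/n<m; m*n/n≡m; m*n%n≡0; [m+kn]%n≡m%n)
open import Data.Nat.Tactic.RingSolver using (solve-∀)
open import Relation.Binary.PropositionalEquality using (_≡_; refl; sym; trans; cong; cong₂; module ≡-Reasoning)
open ≡-Reasoning

pdFuel-stable : ∀ {f g n} → n < f → n < g → pdFuel f n ≡ pdFuel g n
pdFuel-stable {suc f} {suc g} {zero}  _       _       = refl
pdFuel-stable {suc f} {suc g} {suc n} (s≤s p) (s≤s q) =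
  cong (λ x → if suc n % 2 ≡ᵇ 0 then 1 else if suc n % 4 ≡ᵇ 1 then 0 else x)
       (pdFuel-stable (≤-trans n/4<n p) (≤-trans n/4<n q))
  where
  n/4<n : suc n / 4 < suc n
  n/4<n = m/n<m (suc n) 4 (s≤s (s≤s z≤n))

pdFuel≡pd : ∀ {f n} → n < f → pdFuel f n ≡ pd n
pdFuel≡pd n<f = pdFuel-stable n<f ≤-refl

pd-2k : ∀ k → pd (k * 2) ≡ 1
pd-2k k rewrite m*n%n≡0 k 2 ⦃ _ ⦄ = refl

k*4≡k*2*2 : ∀ k → k * 4 ≡ k * 2 * 2
k*4≡k*2*2 k = sym (*-assoc k 2 2)

2∣k*4 : ∀ k → 2 ∣ k * 4
2∣k*4 k = divides (k * 2) (k*4≡k*2*2 k)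

pd-4k : ∀ k → pd (k * 4) ≡ 1
pd-4k k = trans (cong pd (k*4≡k*2*2 k)) (pd-2k (k * 2))

pd-4k+1 : ∀ k → pd (1 + k * 4) ≡ 0
pd-4k+1 k rewrite %-remove-+ʳ 1 (2∣k*4 k) | [m+kn]%n≡m%n 1 k 4 ⦃ _ ⦄ = refl

pd-4k+2 : ∀ k → pd (2 + k * 4) ≡ 1
pd-4k+2 k = trans (cong (λ m → pd (2 + m)) (k*4≡k*2*2 k)) (pd-2k (1 + k * 2))

pd-4k+3 : ∀ k → pd (3 + k * 4) ≡ pd k
pd-4k+3 k rewrite %-remove-+ʳ 3 (2∣k*4 k) | [m+kn]%n≡m%n 3 k 4 ⦃ _ ⦄ =
  trans (cong (pdFuel (3 + k * 4)) quotient) (pdFuel≡pd (s≤s (m≤n⇒m≤o+n 2 (m≤m*n k 4))))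
  where
  quotient : (3 + k * 4) / 4 ≡ k
  quotient = trans (+-distrib-/-∣ʳ 3 {d = 4} (divides k refl)) (m*n/n≡m k 4)

sumPdBelow : ℕ → ℕ
sumPdBelow zero    = 0
sumPdBelow (suc n) = sumPdBelow n + pd n

sumPd≡sumPdBelow : ∀ n → sumPd n ≡ sumPdBelow (suc n)
sumPd≡sumPdBelow zero    = refl
sumPd≡sumPdBelow (suc n) = cong (_+ pd (suc n)) (sumPd≡sumPdBelow n)

sumPdBelow-4k : ∀ k → sumPdBelow (k * 4) ≡ k * 2 + sumPdBelow k
sumPdBelow-4k zero    = refl
sumPdBelow-4k (suc k) = begin
  sumPdBelow (k * 4) + pd (k * 4) + pd (1 + k * 4) + pd (2 + k * 4) + pd (3 + k * 4)
    ≡⟨ cong₂ _+_ (cong₂ _+_ (cong₂ _+_ (cong₂ _+_ (sumPdBelow-4k k) (pd-4k k))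
                                          (pd-4k+1 k))
                            (pd-4k+2 k))
              (pd-4k+3 k) ⟩
  k * 2 + sumPdBelow k + 1 + 0 + 1 + pd k
    ≡⟨ regroup k (sumPdBelow k) (pd k) ⟩
  suc k * 2 + (sumPdBelow k + pd k) ∎
  where
  regroup : ∀ k s d → k * 2 + s + 1 + 0 + 1 + d ≡ suc k * 2 + (s + d)
  regroup = solve-∀

sumPdBelow-4k+1 : ∀ k → sumPdBelow (1 + k * 4) ≡ k * 2 + sumPdBelow k + 1
sumPdBelow-4k+1 k = cong₂ _+_ (sumPdBelow-4k k) (pd-4k k)

sumPd-4k+1 : ∀ k → sumPd (1 + k * 4) ≡ sumPdBelow (1 + k * 4)
sumPd-4k+1 k = begin
  sumPd (1 + k * 4)                        ≡⟨ sumPd≡sumPdBelow (1 + k * 4) ⟩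
  sumPdBelow (1 + k * 4) + pd (1 + k * 4)  ≡⟨ cong (sumPdBelow (1 + k * 4) +_) (pd-4k+1 k) ⟩
  sumPdBelow (1 + k * 4) + 0               ≡⟨ +-identityʳ _ ⟩
  sumPdBelow (1 + k * 4)                   ∎

repunit₄ : ℕ → ℕ
repunit₄ zero    = 0
repunit₄ (suc r) = 1 + repunit₄ r * 4

repunit₄*3+1 : ∀ r → repunit₄ r * 3 + 1 ≡ 4 ^ r
repunit₄*3+1 zero    = refl
repunit₄*3+1 (suc r) = trans (regroup (repunit₄ r)) (cong (4 *_) (repunit₄*3+1 r))
  where
  regroup : ∀ m → (1 + m * 4) * 3 + 1 ≡ 4 * (m * 3 + 1)
  regroup = solve-∀

[4^r∸1]/3≡repunit₄ : ∀ r → (4 ^ r ∸ 1) / 3 ≡ repunit₄ r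
[4^r∸1]/3≡repunit₄ r = begin
  (4 ^ r ∸ 1) / 3                ≡⟨ cong (λ m → (m ∸ 1) / 3) (repunit₄*3+1 r) ⟨
  (repunit₄ r * 3 + 1 ∸ 1) / 3   ≡⟨ cong (_/ 3) (m+n∸n≡m (repunit₄ r * 3) 1) ⟩
  repunit₄ r * 3 / 3             ≡⟨ m*n/n≡m (repunit₄ r) 3 ⟩
  repunit₄ r                     ∎

sumPdBelow-repunit₄ : ∀ r → sumPdBelow (repunit₄ (suc r)) * 9 ≡ 2 * 4 ^ suc r + 3 * r + 1
sumPdBelow-repunit₄ zero    = refl
sumPdBelow-repunit₄ (suc r) = begin
  sumPdBelow (1 + m * 4) * 9                   ≡⟨ cong (_* 9) (sumPdBelow-4k+1 m) ⟩
  (m * 2 + sumPdBelow m + 1) * 9               ≡⟨ split m (sumPdBelow m) ⟩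
  sumPdBelow m * 9 + (m * 18 + 9)              ≡⟨ cong (_+ (m * 18 + 9)) (sumPdBelow-repunit₄ r) ⟩
  2 * 4 ^ suc r + 3 * r + 1 + (m * 18 + 9)     ≡⟨ cong (λ x → 2 * x + 3 * r + 1 + (m * 18 + 9)) (repunit₄*3+1 (suc r)) ⟨
  2 * (m * 3 + 1) + 3 * r + 1 + (m * 18 + 9)   ≡⟨ collect m r ⟩
  2 * (4 * (m * 3 + 1)) + 3 * suc r + 1        ≡⟨ cong (λ x → 2 * (4 * x) + 3 * suc r + 1) (repunit₄*3+1 (suc r)) ⟩
  2 * 4 ^ suc (suc r) + 3 * suc r + 1          ∎
  where
  m : ℕ
  m = repunit₄ (suc r)
  split : ∀ m s → (m * 2 + s + 1) * 9 ≡ s * 9 + (m * 18 + 9)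
  split = solve-∀
  collect : ∀ m r → 2 * (m * 3 + 1) + 3 * r + 1 + (m * 18 + 9) ≡ 2 * (4 * (m * 3 + 1)) + 3 * suc r + 1
  collect = solve-∀

mainTheorem13 : (r : ℕ) → sumPd ((4 ^ (r + 1) ∸ 1) / 3) ≡ (2 * 4 ^ (r + 1) + 3 * r + 1) / 9
mainTheorem13 r = begin
  sumPd ((4 ^ (r + 1) ∸ 1) / 3)              ≡⟨ cong (λ e → sumPd ((4 ^ e ∸ 1) / 3)) r+1≡1+r ⟩
  sumPd ((4 ^ suc r ∸ 1) / 3)                ≡⟨ cong sumPd ([4^r∸1]/3≡repunit₄ (suc r)) ⟩
  sumPd (1 + repunit₄ r * 4)                 ≡⟨ sumPd-4k+1 (repunit₄ r) ⟩
  sumPdBelow (repunit₄ (suc r))              ≡⟨ m*n/n≡m _ 9 ⟨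
  sumPdBelow (repunit₄ (suc r)) * 9 / 9      ≡⟨ cong (_/ 9) (sumPdBelow-repunit₄ r) ⟩
  (2 * 4 ^ suc r + 3 * r + 1) / 9            ≡⟨ cong (λ e → (2 * 4 ^ e + 3 * r + 1) / 9) r+1≡1+r ⟨
  (2 * 4 ^ (r + 1) + 3 * r + 1) / 9          ∎
  where
  r+1≡1+r : r + 1 ≡ suc r
  r+1≡1+r = +-comm r 1
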